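{- In the formal theory $\mathrm{SMT}|L'$ (described in the context), for every formula $\Phi$, $$\vdash_{\mathrm{SMT}|L'} \ \forall\alpha\,(\Phi(\alpha)) \Leftrightarrow \forall x\,(\Phi(x)),$$ i.e. quantification over all matrices is equivalent to quantification over all sets.
   Context: $\mathrm{SMT}|L'$ is the following first-order theory with identity (the restriction of "set matrix theory" SMT to the language $L'$). Language $L'$: a constant $\emptyset$; countably many variables $x,y,z,u,\dots$ ranging over sets; countably many variables $\alpha,\beta,\gamma,\dots$ ranging over matrices; a single unary function symbol $f_{1\times1}$, with $f_{1\times 1}(t)$ written $[t]$; binary predicate symbols $\in$ and $=$; the usual connectives and quantifiers. Terms: $\emptyset$ and set variables are terms; if $t$ is a term then $[t]$ is a term. Atomic formulas: $t_1\in t_2$, $t_1=t_2$ for terms $t_1,t_2$. Formulas are closed under connectives and quantification $Qx$ over set variables; moreover, if $\Phi(x)$ is a formula with $x$ a free set variable, then $Q\alpha\,\Phi(\alpha)$ is a formula, where $\Phi(\alpha)$ results from replacing $x$ everywhere by $\alpha$ (so matrix variables occur only bound). The logic includes the substitution rule $\forall\alpha\,\Psi(\alpha)\Rightarrow \Psi([x])$ for every set variable $x$. Notation: $x\subseteq y$ abbreviates $\forall\alpha(\alpha\in x\Rightarrow\alpha\in y)$; for a set $y$, $\{y\}$ denotes the unique set with $\forall\alpha(\alpha\in\{y\}\Leftrightarrow\alpha=y)$; $\emptyset$ denotes the unique set with no elements. Axioms of $\mathrm{SMT}|L'$: (1) Set matrix axiom: $\forall x\,\exists\alpha\,(\alpha=[x])$.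 (2) Reduction: $\forall x\,([x]=x)$. (3) Extensionality: $\forall x\forall y\,(x=y\Leftrightarrow x\subseteq y\wedge y\subseteq x)$. (4) Emptiness: $\exists x\,\forall\alpha\,(\alpha\notin x)$. (5) Separation (scheme, every formula $\Phi$): $\forall x\,\exists y\,\forall\alpha\,(\alpha\in y\Leftrightarrow \alpha\in x\wedge\Phi(\alpha))$. (6) Pair: $\forall\alpha\forall\beta\,\exists x\,\forall\gamma\,(\gamma\in x\Leftrightarrow\gamma=\alpha\vee\gamma=\beta)$. (7) Set of matrices: $\forall x\,\exists y\,(\forall\alpha(\alpha\in x\Rightarrow[\alpha]\in y)\wedge\forall\beta(\beta\in y\Rightarrow\exists\gamma(\beta=[\gamma]\wedge\gamma\in x)))$. (8) Sum set: $\forall x\,(\forall\alpha(\alpha\in x\Rightarrow\exists u(u=\alpha))\Rightarrow\exists y\,\forall\beta(\beta\in y\Leftrightarrow\exists z(z\in x\wedge\beta\in z)))$. (9) Power set: $\forall x\,\exists y\,(\forall\alpha(\alpha\in y\Rightarrow\exists u(u=\alpha))\wedge\forall z(z\in y\Leftrightarrow z\subseteq x))$. (10) Infinity: $\exists x\,(\emptyset\in x\wedge\forall y(y\in x\Rightarrow\{y\}\in x))$. (11) Substitution (scheme, every formula $\Phi$): $\forall x\,(\forall\alpha(\alpha\in x\Rightarrow\exists!\beta\,\Phi(\alpha,\beta))\Rightarrow\exists y\,\forall\beta(\beta\in y\Leftrightarrow\exists\gamma(\gamma\in x\wedge\Phi(\gamma,\beta))))$. (12) Foundation: $\forall x\,(\exists\alpha(\alpha\in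 x)\wedge\forall\beta(\beta\in x\Rightarrow\exists y(\beta=y))\Rightarrow\exists z(z\in x\wedge\forall\gamma(\gamma\in z\Rightarrow\gamma\notin x)))$. -}

module Defs where

-- Matrix variables occur only
-- bound: following the paper's formation rule, "Q α Φ(α)" is formed from a
-- formula Φ(x) with a distinguished free set variable x (here: index 0) by
-- binding that variable with a *matrix* quantifier.

open import Data.Nat using (ℕ; zero; suc)
open import Data.Fin using (Fin; zero; suc)
open import Data.List using (List; []; _∷_; map)
open import Data.List.Membership.Propositional using (_∈_)

infix  7 [_]
data Term (n : ℕ) : Set where
  var : Fin n → Term n
  ∅   : Term n
  [_] : Term n → Term n          -- the function symbol f_{1×1}

infix  6 _∈'_ _≐_
infixr 4 _⇒_
data Form (n : ℕ) : Set where
  _∈'_ : Term n → Term n → Form n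
  _≐_  : Term n → Term n → Form n
  ⊥'   : Form n
  _⇒_  : Form n → Form n → Form n
  ∀S   : Form (suc n) → Form n
  ∀M   : Form (suc n) → Form n

infixr 5 _∧_ _∨_
infix  3 _⇔_
¬' : ∀ {n} → Form n → Form n
¬' φ = φ ⇒ ⊥'

_∧_ : ∀ {n} → Form n → Form n → Form n
φ ∧ ψ = ¬' (φ ⇒ ¬' ψ)

_∨_ : ∀ {n} → Form n → Form n → Form n
φ ∨ ψ = ¬' φ ⇒ ψ

_⇔_ : ∀ {n} → Form n → Form n → Form n
φ ⇔ ψ = (φ ⇒ ψ) ∧ (ψ ⇒ φ)

∃S : ∀ {n} → Form (suc n) → Form n
∃S φ = ¬' (∀S (¬' φ))

∃M : ∀ {n} → Form (suc n) → Form n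
∃M φ = ¬' (∀M (¬' φ))

Ren : ℕ → ℕ → Set
Ren m n = Fin m → Fin n

liftR : ∀ {m n} → Ren m n → Ren (suc m) (suc n)
liftR ρ zero    = zero
liftR ρ (suc i) = suc (ρ i)

renT : ∀ {m n} → Ren m n → Term m → Term n
renT ρ (var i) = var (ρ i)
renT ρ ∅       = ∅
renT ρ [ t ]   = [ renT ρ t ]

renF : ∀ {m n} → Ren m n → Form m → Form n
renF ρ (s ∈' t) = renT ρ s ∈' renT ρ t
renF ρ (s ≐ t)  = renT ρ s ≐ renT ρ t
renF ρ ⊥'       = ⊥'
renF ρ (φ ⇒ ψ)  = renF ρ φ ⇒ renF ρ ψ
renF ρ (∀S φ)   = ∀S (renF (liftR ρ) φ)
renF ρ (∀M φ)   = ∀M (renF (liftR ρ) φ)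

wkT : ∀ {n} → Term n → Term (suc n)
wkT = renT suc

wkF : ∀ {n} → Form n → Form (suc n)
wkF = renF suc

Sub : ℕ → ℕ → Set
Sub m n = Fin m → Term n

liftS : ∀ {m n} → Sub m n → Sub (suc m) (suc n)
liftS σ zero    = var zero
liftS σ (suc i) = wkT (σ i)

subT : ∀ {m n} → Sub m n → Term m → Term n
subT σ (var i) = σ i
subT σ ∅       = ∅
subT σ [ t ]   = [ subT σ t ]

subF : ∀ {m n} → Sub m n → Form m → Form n
subF σ (s ∈' t) = subT σ s ∈' subT σ t
subF σ (s ≐ t)  = subT σ s ≐ subT σ t
subF σ ⊥'       = ⊥'
subF σ (φ ⇒ ψ)  = subF σ φ ⇒ subF σ ψ
subF σ (∀S φ)   = ∀S (subF (liftS σ) φ)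
subF σ (∀M φ)   = ∀M (subF (liftS σ) φ)

sub0 : ∀ {n} → Term n → Sub (suc n) n
sub0 t zero    = t
sub0 t (suc i) = var i

infix 8 _⟨_⟩
_⟨_⟩ : ∀ {n} → Form (suc n) → Term n → Form n
φ ⟨ t ⟩ = subF (sub0 t) φ

boxVar0 : ∀ {n} → Sub (suc n) (suc n)
boxVar0 zero    = [ var zero ]
boxVar0 (suc i) = var (suc i)

x0 : ∀ {n} → Term (suc n)
x0 = var zero
x1 : ∀ {n} → Term (suc (suc n))
x1 = var (suc zero)
x2 : ∀ {n} → Term (suc (suc (suc n)))
x2 = var (suc (suc zero))
x3 : ∀ {n} → Term (suc (suc (suc (suc n))))
x3 = var (suc (suc (suc zero)))

_⊆'_ : ∀ {n} → Term n → Term n → Form n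
s ⊆' t = ∀M (x0 ∈' wkT s ⇒ x0 ∈' wkT t)

IsSingleton : ∀ {n} → Term n → Term n → Form n
IsSingleton s t = ∀M (x0 ∈' wkT s ⇔ x0 ≐ wkT t)

∃!M : ∀ {n} → Form (suc n) → Form n
∃!M ψ = ∃M (ψ ∧ ∀M (renF (liftR suc) ψ ⇒ x0 ≐ x1))

-- Separation: Φ(α) has α = index 0, parameters = indices ≥ 1.
sepRen : ∀ {n} → Ren (suc n) (suc (suc (suc n)))
sepRen zero    = zero
sepRen (suc i) = suc (suc (suc i))

-- Substitution scheme: Φ(α,β) has β = index 0, α = index 1, parameters ≥ 2.
substRen₁ : ∀ {n} → Ren (suc (suc n)) (suc (suc (suc n)))
substRen₁ zero          = zero
substRen₁ (suc zero)    = suc zero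
substRen₁ (suc (suc i)) = suc (suc (suc i))

substRen₂ : ∀ {n} → Ren (suc (suc n)) (suc (suc (suc (suc n))))
substRen₂ zero          = suc zero
substRen₂ (suc zero)    = zero
substRen₂ (suc (suc i)) = suc (suc (suc (suc i)))

data Axiom {n : ℕ} : Form n → Set where
  ax-∅ : Axiom (∀M (¬' (x0 ∈' ∅)))
  ax-setMatrix : Axiom (∀S (∃M (x0 ≐ [ x1 ])))
  ax-reduction : Axiom (∀S ([ x0 ] ≐ x0))
  ax-ext : Axiom (∀S (∀S (x1 ≐ x0 ⇔ (x1 ⊆' x0 ∧ x0 ⊆' x1))))
  ax-empty : Axiom (∃S (∀M (¬' (x0 ∈' x1))))
  ax-sep : (Φ : Form (suc n)) →
    Axiom (∀S (∃S (∀M (x0 ∈' x1 ⇔ (x0 ∈' x2 ∧ renF sepRen Φ)))))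
  ax-pair : Axiom (∀M (∀M (∃S (∀M (x0 ∈' x1 ⇔ (x0 ≐ x3 ∨ x0 ≐ x2))))))
  ax-matrices : Axiom (∀S (∃S (
      ∀M (x0 ∈' x2 ⇒ [ x0 ] ∈' x1)
    ∧ ∀M (x0 ∈' x1 ⇒ ∃M (x1 ≐ [ x0 ] ∧ x0 ∈' x3)))))
  ax-sum : Axiom (∀S (
      ∀M (x0 ∈' x1 ⇒ ∃S (x0 ≐ x1))
    ⇒ ∃S (∀M (x0 ∈' x1 ⇔ ∃S (x0 ∈' x3 ∧ x1 ∈' x0)))))
  ax-power : Axiom (∀S (∃S (
      ∀M (x0 ∈' x1 ⇒ ∃S (x0 ≐ x1))
    ∧ ∀S (x0 ∈' x1 ⇔ x0 ⊆' x2))))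
  ax-inf : Axiom (∃S (∅ ∈' x0 ∧ ∀S (x0 ∈' x1 ⇒ ∃S (IsSingleton x0 x1 ∧ x0 ∈' x2))))
  ax-subst : (Φ : Form (suc (suc n))) →
    Axiom (∀S (
        ∀M (x0 ∈' x1 ⇒ ∃!M (renF substRen₁ Φ))
      ⇒ ∃S (∀M (x0 ∈' x1 ⇔ ∃M (x0 ∈' x3 ∧ renF substRen₂ Φ)))))
  ax-found : Axiom (∀S (
      (∃M (x0 ∈' x1) ∧ ∀M (x0 ∈' x1 ⇒ ∃S (x1 ≐ x0)))
    ⇒ ∃S (x0 ∈' x1 ∧ ∀M (x0 ∈' x1 ⇒ ¬' (x0 ∈' x2)))))

-- Classical natural deduction for two-sorted first-order logic with
-- identity, where the matrix quantifier obeys the paper's substitution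
-- rule ∀α Ψ(α) ⇒ Ψ([x]) and the matching introduction rule.

infix 2 _⊢_
data _⊢_ {n : ℕ} (Γ : List (Form n)) : Form n → Set where
  hyp   : ∀ {φ} → φ ∈ Γ → Γ ⊢ φ
  axm   : ∀ {φ} → Axiom φ → Γ ⊢ φ
  ⇒I    : ∀ {φ ψ} → φ ∷ Γ ⊢ ψ → Γ ⊢ φ ⇒ ψ
  ⇒E    : ∀ {φ ψ} → Γ ⊢ φ ⇒ ψ → Γ ⊢ φ → Γ ⊢ ψ
  dne   : ∀ {φ} → Γ ⊢ ¬' (¬' φ) → Γ ⊢ φ
  ∀S-I  : ∀ {φ} → map wkF Γ ⊢ φ → Γ ⊢ ∀S φ
  ∀S-E  : ∀ {φ} → Γ ⊢ ∀S φ → (t : Term n) → Γ ⊢ φ ⟨ t ⟩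
  ∀M-I  : ∀ {φ} → map wkF Γ ⊢ subF boxVar0 φ → Γ ⊢ ∀M φ
  ∀M-E  : ∀ {φ} → Γ ⊢ ∀M φ → (x : Fin n) → Γ ⊢ φ ⟨ [ var x ] ⟩
  ≐-refl  : ∀ {t} → Γ ⊢ t ≐ t
  ≐-subst : ∀ {s t} (φ : Form (suc n)) → Γ ⊢ s ≐ t → Γ ⊢ φ ⟨ s ⟩ → Γ ⊢ φ ⟨ t ⟩

⊢SMT : ∀ {n} → Form n → Set
⊢SMT φ = [] ⊢ φ

-- Every matrix is a 1×1 matrix [x] of a set x, and reduction gives [x] = x.
-- So ∀α Φ(α) yields Φ([x]) and hence Φ(x); conversely ∀x Φ(x) instantiated
-- at [x] is exactly the premise of the matrix ∀-introduction rule.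
module Submission where

open import Data.Nat using (ℕ; suc)
open import Data.Fin using (zero; suc)
open import Data.List using (List; _∷_; map)
open import Data.List.Relation.Unary.Any using (here)
open import Relation.Binary.PropositionalEquality
  using (_≡_; refl; cong; cong₂; subst; module ≡-Reasoning)
open import Defs

liftS-cong : ∀ {m n} {σ τ : Sub m n} → (∀ i → σ i ≡ τ i) → ∀ i → liftS σ i ≡ liftS τ i
liftS-cong σ≗τ zero    = refl
liftS-cong σ≗τ (suc i) = cong wkT (σ≗τ i)

subT-cong : ∀ {m n} {σ τ : Sub m n} → (∀ i → σ i ≡ τ i) → ∀ t → subT σ t ≡ subT τ t
subT-cong σ≗τ (var i) = σ≗τ i
subT-cong σ≗τ ∅       = refl
subT-cong σ≗τ [ t ]   = cong [_] (subT-cong σ≗τ t)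

subF-cong : ∀ {m n} {σ τ : Sub m n} → (∀ i → σ i ≡ τ i) → ∀ φ → subF σ φ ≡ subF τ φ
subF-cong σ≗τ (s ∈' t) = cong₂ _∈'_ (subT-cong σ≗τ s) (subT-cong σ≗τ t)
subF-cong σ≗τ (s ≐ t)  = cong₂ _≐_ (subT-cong σ≗τ s) (subT-cong σ≗τ t)
subF-cong σ≗τ ⊥'       = refl
subF-cong σ≗τ (φ ⇒ ψ)  = cong₂ _⇒_ (subF-cong σ≗τ φ) (subF-cong σ≗τ ψ)
subF-cong σ≗τ (∀S φ)   = cong ∀S (subF-cong (liftS-cong σ≗τ) φ)
subF-cong σ≗τ (∀M φ)   = cong ∀M (subF-cong (liftS-cong σ≗τ) φ)

liftS-liftR : ∀ {k m n} (σ : Sub m n) (ρ : Ren k m) →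
              ∀ i → liftS σ (liftR ρ i) ≡ liftS (λ j → σ (ρ j)) i
liftS-liftR σ ρ zero    = refl
liftS-liftR σ ρ (suc i) = refl

subT-renT : ∀ {k m n} (σ : Sub m n) (ρ : Ren k m) →
            ∀ t → subT σ (renT ρ t) ≡ subT (λ i → σ (ρ i)) t
subT-renT σ ρ (var i) = refl
subT-renT σ ρ ∅       = refl
subT-renT σ ρ [ t ]   = cong [_] (subT-renT σ ρ t)

subF-renF : ∀ {k m n} (σ : Sub m n) (ρ : Ren k m) →
            ∀ φ → subF σ (renF ρ φ) ≡ subF (λ i → σ (ρ i)) φ

subF-renF-under-binder : ∀ {k m n} (σ : Sub m n) (ρ : Ren k m) →
  ∀ φ → subF (liftS σ) (renF (liftR ρ) φ) ≡ subF (liftS (λ i → σ (ρ i))) φ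
subF-renF-under-binder σ ρ φ = begin
  subF (liftS σ) (renF (liftR ρ) φ)    ≡⟨ subF-renF (liftS σ) (liftR ρ) φ ⟩
  subF (λ i → liftS σ (liftR ρ i)) φ   ≡⟨ subF-cong (liftS-liftR σ ρ) φ ⟩
  subF (liftS (λ i → σ (ρ i))) φ       ∎
  where open ≡-Reasoning

subF-renF σ ρ (s ∈' t) = cong₂ _∈'_ (subT-renT σ ρ s) (subT-renT σ ρ t)
subF-renF σ ρ (s ≐ t)  = cong₂ _≐_ (subT-renT σ ρ s) (subT-renT σ ρ t)
subF-renF σ ρ ⊥'       = refl
subF-renF σ ρ (φ ⇒ ψ)  = cong₂ _⇒_ (subF-renF σ ρ φ) (subF-renF σ ρ ψ)
subF-renF σ ρ (∀S φ)   = cong ∀S (subF-renF-under-binder σ ρ φ)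
subF-renF σ ρ (∀M φ)   = cong ∀M (subF-renF-under-binder σ ρ φ)

liftS-id : ∀ {n} {σ : Sub n n} → (∀ i → σ i ≡ var i) → ∀ i → liftS σ i ≡ var i
liftS-id σ≗var zero    = refl
liftS-id σ≗var (suc i) = cong wkT (σ≗var i)

subT-id : ∀ {n} {σ : Sub n n} → (∀ i → σ i ≡ var i) → ∀ t → subT σ t ≡ t
subT-id σ≗var (var i) = σ≗var i
subT-id σ≗var ∅       = refl
subT-id σ≗var [ t ]   = cong [_] (subT-id σ≗var t)

subF-id : ∀ {n} {σ : Sub n n} → (∀ i → σ i ≡ var i) → ∀ φ → subF σ φ ≡ φ
subF-id σ≗var (s ∈' t) = cong₂ _∈'_ (subT-id σ≗var s) (subT-id σ≗var t)
subF-id σ≗var (s ≐ t)  = cong₂ _≐_ (subT-id σ≗var s) (subT-id σ≗var t)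
subF-id σ≗var ⊥'       = refl
subF-id σ≗var (φ ⇒ ψ)  = cong₂ _⇒_ (subF-id σ≗var φ) (subF-id σ≗var ψ)
subF-id σ≗var (∀S φ)   = cong ∀S (subF-id (liftS-id σ≗var) φ)
subF-id σ≗var (∀M φ)   = cong ∀M (subF-id (liftS-id σ≗var) φ)

-- renF (liftR suc) Φ is the body of a weakened quantifier wkF (Q Φ).
weakened-body-at-x0 : ∀ {n} (Φ : Form (suc n)) → (renF (liftR suc) Φ) ⟨ x0 ⟩ ≡ Φ
weakened-body-at-x0 Φ = begin
  (renF (liftR suc) Φ) ⟨ x0 ⟩          ≡⟨ subF-renF (sub0 x0) (liftR suc) Φ ⟩
  subF (λ i → sub0 x0 (liftR suc i)) Φ ≡⟨ subF-id sub0-x0-after-liftR-suc Φ ⟩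
  Φ                                    ∎
  where
  open ≡-Reasoning
  sub0-x0-after-liftR-suc : ∀ i → sub0 x0 (liftR suc i) ≡ var i
  sub0-x0-after-liftR-suc zero    = refl
  sub0-x0-after-liftR-suc (suc i) = refl

weakened-body-at-[x0] : ∀ {n} (Φ : Form (suc n)) →
                        (renF (liftR suc) Φ) ⟨ [ x0 ] ⟩ ≡ subF boxVar0 Φ
weakened-body-at-[x0] Φ = begin
  (renF (liftR suc) Φ) ⟨ [ x0 ] ⟩          ≡⟨ subF-renF (sub0 [ x0 ]) (liftR suc) Φ ⟩
  subF (λ i → sub0 [ x0 ] (liftR suc i)) Φ ≡⟨ subF-cong sub0-[x0]-after-liftR-suc Φ ⟩
  subF boxVar0 Φ                           ∎
  where
  open ≡-Reasoning
  sub0-[x0]-after-liftR-suc : ∀ i → sub0 [ x0 ] (liftR suc i) ≡ boxVar0 i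
  sub0-[x0]-after-liftR-suc zero    = refl
  sub0-[x0]-after-liftR-suc (suc i) = refl

∧-I : ∀ {n} {Γ : List (Form n)} {φ ψ} →
      (φ ⇒ ¬' ψ) ∷ Γ ⊢ φ → (φ ⇒ ¬' ψ) ∷ Γ ⊢ ψ → Γ ⊢ φ ∧ ψ
∧-I ⊢φ ⊢ψ = ⇒I (⇒E (⇒E (hyp (here refl)) ⊢φ) ⊢ψ)

∀M⇒∀S : ∀ {n} {Γ : List (Form n)} (Φ : Form (suc n)) → Γ ⊢ ∀M Φ ⇒ ∀S Φ
∀M⇒∀S {Γ = Γ} Φ = ⇒I (∀S-I (subst (wkF (∀M Φ) ∷ map wkF Γ ⊢_) (weakened-body-at-x0 Φ) Φ[x0]))
  where
  Φ[[x0]] : wkF (∀M Φ) ∷ map wkF Γ ⊢ (renF (liftR suc) Φ) ⟨ [ x0 ] ⟩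
  Φ[[x0]] = ∀M-E (hyp (here refl)) zero

  Φ[x0] : wkF (∀M Φ) ∷ map wkF Γ ⊢ (renF (liftR suc) Φ) ⟨ x0 ⟩
  Φ[x0] = ≐-subst (renF (liftR suc) Φ) (∀S-E (axm ax-reduction) x0) Φ[[x0]]

∀S⇒∀M : ∀ {n} {Γ : List (Form n)} (Φ : Form (suc n)) → Γ ⊢ ∀S Φ ⇒ ∀M Φ
∀S⇒∀M {Γ = Γ} Φ = ⇒I (∀M-I (subst (wkF (∀S Φ) ∷ map wkF Γ ⊢_) (weakened-body-at-[x0] Φ)
                                   (∀S-E (hyp (here refl)) [ x0 ])))

theorem2 : ∀ {n : ℕ} (Φ : Form (suc n)) → ⊢SMT (∀M Φ ⇔ ∀S Φ)
theorem2 Φ = ∧-I (∀M⇒∀S Φ) (∀S⇒∀M Φ)
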